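{- Let $p\geq7$ be prime and let $\varphi:\mathbb{F}_p\to\mathbb{F}_p$ be the map induced by the integer polynomial $\varphi(x)=\frac{(1-x)^p-1+x^p}{p}$. Then $|\varphi^{ -1}(0)|\leq p-3$ and $|\varphi^{ -1}(a)|\leq p-4$ for every $a\neq0$ in $\mathbb{F}_p$. -}

module Defs where

open import Data.Nat as ℕ using (ℕ; NonZero)
open import Data.Integer as ℤ using (ℤ; +_; _-_; _+_; _^_; _/ℕ_; _%ℕ_)
open import Data.Fin using (Fin; toℕ)
open import Data.List using (List; length; filter; allFin)

-- The integer polynomial φ(x) = ((1 - x)^p - 1 + x^p) / p, evaluated at an
-- integer x.  The numerator is always divisible by p (p prime), so the
-- integer division /ℕ is exact here.
φ : (p : ℕ) .{{_ : NonZero p}} → ℤ → ℤ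
φ p x = (((+ 1 - x) ^ p) - + 1 + x ^ p) /ℕ p

φ̄ : (p : ℕ) .{{_ : NonZero p}} → Fin p → ℕ
φ̄ p x = φ p (+ toℕ x) %ℕ p

fiberSize : (p : ℕ) .{{_ : NonZero p}} → Fin p → ℕ
fiberSize p a = length (filter (λ x → φ̄ p x ℕ.≟ toℕ a) (allFin p))

module Submission where

-- By the binomial theorem φ(x) = Σ_{k=1}^{p-1} c_k x^k with k c_k ≡ -1 (mod p).  With the
-- power sums S_j = Σ_{x<p} x^j (S_j ≡ 0 for j < p - 1, S_{p-1} ≡ -1, S_{p+t} ≡ S_{t+1}
-- by Fermat) this yields the moment congruence
--     (m + 1) Σ_{x<p} (φ(x) - A) x^m ≡ -1      (0 ≤ m < p - 1, A ∈ ℤ).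
-- Fibre points drop out, so the same holds for T_m = Σ_{x∈L} (φ(x) - A) x^m over the
-- complement L of the fibre.  If |L| ≤ 2, T obeys a linear recurrence of order two, and
-- three of its steps against m = 0, …, 4 force p ∣ 2.  Over a ≠ 0 we have 0, 1 ∈ L; if
-- |L| ≤ 3, then (T_m)_{m≥1} is a power sum over 1 and one more point, and m = 1, …, 4
-- again force p ∣ 2.  The file follows this order: sums and binomials, congruences,
-- Fermat and power sums, the moments of φ, recurrences, and the fibre count.

open import Defs using (φ; φ̄; fiberSize)
open import Data.Nat as ℕ
  using (ℕ; NonZero; zero; suc; _≤_; _<_; _∸_; z≤n; s≤s; _≤?_)
import Data.Nat.Properties as ℕP
import Data.Nat.Divisibility as ℕD
import Data.Nat.DivMod as ℕDM
open import Data.Nat.Induction using (<-rec)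
open import Data.Nat.Combinatorics
  using (_C_; nCn≡1; nC1≡n; nCk≡nC[n∸k]; nCk+nC[k+1]≡[n+1]C[k+1])
open import Data.Nat.Primality using (Prime; euclidsLemma; prime⇒irreducible)
open import Data.Integer as ℤ
  using (ℤ; +_; -_; _-_; _+_; _*_; _^_; 0ℤ; 1ℤ; -1ℤ; _/ℕ_; _%ℕ_)
import Data.Integer.Properties as ℤP
open import Data.Integer.Divisibility.Signed using (_∣_; divides; ∣ᵤ⇒∣; ∣⇒∣ᵤ)
import Data.Integer.Divisibility.Signed as ℤD
open import Data.Integer.DivMod using (a≡a%ℕn+[a/ℕn]*n; n%ℕd<d)
open import Data.Integer.Tactic.RingSolver using (solve-∀)
open import Data.Fin as Fin using (Fin; toℕ)
import Data.Fin.Properties as FinP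
open import Data.List using (List; []; _∷_; length; filter; tabulate; allFin)
open import Data.List.Properties using (length-tabulate; filter-accept)
open import Data.Product using (_×_; _,_; ∃; ∃₂)
open import Data.Sum using (_⊎_; inj₁; inj₂)
open import Function using (_∘_)
open import Level using (0ℓ)
open import Relation.Nullary using (¬_; Dec; yes; no; contradiction)
open import Relation.Nullary.Decidable using (True; toWitness)
open import Relation.Unary using (Pred; Decidable)
open import Relation.Unary.Properties using (∁?)
open import Relation.Binary using (Setoid; tri<; tri≈; tri>)
open import Relation.Binary.PropositionalEquality
  using (_≡_; _≢_; refl; sym; trans; cong; cong₂; subst; module ≡-Reasoning)
import Relation.Binary.Reasoning.Setoid as SetoidReasoning
open import Algebra.Properties.Semiring.Sum ℤP.+-*-semiring
  using (sum; sum-cong-≗; ∑-distrib-+; ∑-comm; *-distribˡ-sum; sum-init-last; sum-replicate)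
open import Algebra.Properties.CommutativeSemiring.Binomial ℤP.+-*-commutativeSemiring
  as Binomial using (binomialExpansion; binomialTerm)
import Algebra.Properties.Semiring.Exp ℤP.+-*-semiring as Exp
import Algebra.Definitions.RawMonoid ℤ.+-0-rawMonoid as Mult

-- Σ n f = f 0 + f 1 + ⋯ + f (n - 1): the library sum over Fin n, read through
-- toℕ.  It unfolds definitionally as  Σ (suc n) f = f 0 + Σ n (f ∘ suc).
Σ : ℕ → (ℕ → ℤ) → ℤ
Σ n f = sum {n} (λ i → f (toℕ i))

Σ-cong : ∀ n {f g : ℕ → ℤ} → (∀ i → i < n → f i ≡ g i) → Σ n f ≡ Σ n g
Σ-cong n f≡g = sum-cong-≗ {n} (λ i → f≡g (toℕ i) (FinP.toℕ<n i))

Σ-+ : ∀ n (f g : ℕ → ℤ) → Σ n (λ i → f i + g i) ≡ Σ n f + Σ n g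
Σ-+ n f g = ∑-distrib-+ {n} (λ i → f (toℕ i)) (λ i → g (toℕ i))

Σ-* : ∀ n c (f : ℕ → ℤ) → Σ n (λ i → c * f i) ≡ c * Σ n f
Σ-* n c f = sym (*-distribˡ-sum {n} c (λ i → f (toℕ i)))

Σ-swap : ∀ n m (f : ℕ → ℕ → ℤ) →
         Σ n (λ i → Σ m (λ j → f i j)) ≡ Σ m (λ j → Σ n (λ i → f i j))
Σ-swap n m f = ∑-comm {n} {m} (λ i j → f (toℕ i) (toℕ j))

Σ-last : ∀ n (f : ℕ → ℤ) → Σ (suc n) f ≡ Σ n f + f n
Σ-last n f = trans (sum-init-last {n} (λ i → f (toℕ i)))
  (cong₂ _+_ (sum-cong-≗ {n} (λ i → cong f (FinP.toℕ-inject₁ i)))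
             (cong f (FinP.toℕ-fromℕ n)))

×-agrees : ∀ n x → n Mult.× x ≡ + n * x
×-agrees zero x = sym (ℤP.*-zeroˡ x)
×-agrees (suc n) x = trans (cong (λ y → x + y) (×-agrees n x)) (sym (ℤP.suc-* (+ n) x))

^-agrees : ∀ x n → x Exp.^ n ≡ x ^ n
^-agrees x zero = refl
^-agrees x (suc n) = cong (x *_) (^-agrees x n)

Σ-const : ∀ n c → Σ n (λ _ → c) ≡ + n * c
Σ-const n c = trans (sum-replicate n) (×-agrees n c)

Σ-telescope : ∀ n (F : ℕ → ℤ) → Σ n (λ i → F (suc i) - F i) ≡ F n - F 0
Σ-telescope zero F = sym (ℤP.+-inverseʳ (F 0))
Σ-telescope (suc n) F = trans (cong (λ t → F 1 - F 0 + t) (Σ-telescope n (F ∘ suc)))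
  (collapse (F 0) (F 1) (F (suc n)))
  where
  collapse : ∀ a b c → b - a + (c - b) ≡ c - a
  collapse = solve-∀

binomial : ∀ n X → (1ℤ + X) ^ n ≡ Σ (suc n) (λ k → + (n C k) * X ^ k)
binomial n X = begin
  (1ℤ + X) ^ n             ≡⟨ cong (_^ n) (ℤP.+-comm 1ℤ X) ⟩
  (X + 1ℤ) ^ n             ≡⟨ sym (^-agrees (X + 1ℤ) n) ⟩
  (X + 1ℤ) Exp.^ n         ≡⟨ Binomial.theorem n X 1ℤ ⟩
  binomialExpansion X 1ℤ n ≡⟨ sum-cong-≗ {suc n} term ⟩
  Σ (suc n) (λ k → + (n C k) * X ^ k) ∎
  where
  open ≡-Reasoning
  term : ∀ (k : Fin (suc n)) → binomialTerm X 1ℤ n k ≡ + (n C toℕ k) * X ^ toℕ k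
  term k = begin
    binomialTerm X 1ℤ n k
      ≡⟨ ×-agrees (n C toℕ k) _ ⟩
    + (n C toℕ k) * (X Exp.^ toℕ k * 1ℤ Exp.^ (n ∸ toℕ k))
      ≡⟨ cong (λ y → + (n C toℕ k) * y) (cong₂ _*_ (^-agrees X (toℕ k))
           (trans (^-agrees 1ℤ (n ∸ toℕ k)) (ℤP.^-zeroˡ (n ∸ toℕ k)))) ⟩
    + (n C toℕ k) * (X ^ toℕ k * 1ℤ)
      ≡⟨ cong (λ y → + (n C toℕ k) * y) (ℤP.*-identityʳ (X ^ toℕ k)) ⟩
    + (n C toℕ k) * X ^ toℕ k ∎

absorption : ∀ n k → suc k ℕ.* (suc n C suc k) ≡ suc n ℕ.* (n C k)
absorption n zero =
  trans (ℕP.+-identityʳ (suc n C 1)) (trans (nC1≡n (suc n)) (sym (ℕP.*-identityʳ (suc n))))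
absorption zero (suc k) = ℕP.*-zeroʳ (suc (suc k))
absorption (suc n) (suc k) = begin
  suc (suc k) ℕ.* (suc (suc n) C suc (suc k))
    ≡⟨ cong (suc (suc k) ℕ.*_) (sym (nCk+nC[k+1]≡[n+1]C[k+1] (suc n) (suc k))) ⟩
  suc (suc k) ℕ.* (suc n C suc k ℕ.+ suc n C suc (suc k))
    ≡⟨ ℕP.*-distribˡ-+ (suc (suc k)) (suc n C suc k) _ ⟩
  suc (suc k) ℕ.* (suc n C suc k) ℕ.+ suc (suc k) ℕ.* (suc n C suc (suc k))
    ≡⟨ cong₂ ℕ._+_ (cong (suc n C suc k ℕ.+_) (absorption n k)) (absorption n (suc k)) ⟩
  suc n C suc k ℕ.+ suc n ℕ.* (n C k) ℕ.+ suc n ℕ.* (n C suc k)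
    ≡⟨ ℕP.+-assoc (suc n C suc k) _ _ ⟩
  suc n C suc k ℕ.+ (suc n ℕ.* (n C k) ℕ.+ suc n ℕ.* (n C suc k))
    ≡⟨ cong (suc n C suc k ℕ.+_) (sym (ℕP.*-distribˡ-+ (suc n) (n C k) _)) ⟩
  suc n C suc k ℕ.+ suc n ℕ.* (n C k ℕ.+ n C suc k)
    ≡⟨ cong (λ c → suc n C suc k ℕ.+ suc n ℕ.* c) (nCk+nC[k+1]≡[n+1]C[k+1] n k) ⟩
  suc (suc n) ℕ.* (suc n C suc k) ∎
  where open ≡-Reasoning

C-pred : ∀ j → suc j C j ≡ suc j
C-pred j = trans (nCk≡nC[n∸k] (ℕP.n≤1+n j))
  (trans (cong (suc j C_) (ℕP.m+n∸n≡m 1 j)) (nC1≡n (suc j)))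

listSum : {A : Set} → (A → ℤ) → List A → ℤ
listSum w [] = 0ℤ
listSum w (x ∷ xs) = w x + listSum w xs

listSum-tabulate : ∀ {A : Set} {n} (w : A → ℤ) (f : Fin n → A) →
                   listSum w (tabulate f) ≡ sum {n} (λ i → w (f i))
listSum-tabulate {n = zero} w f = refl
listSum-tabulate {n = suc n} w f =
  cong (λ s → w (f Fin.zero) + s) (listSum-tabulate w (f ∘ Fin.suc))

module Congruence (p : ℕ) .{{_ : NonZero p}} where

  infix 4 _≋_
  record _≋_ (a b : ℤ) : Set where
    constructor congruent
    field p∣a-b : + p ∣ (a - b)

  ≋-by : ∀ {a b} c → a - b ≡ c * + p → a ≋ b
  ≋-by c eq = congruent (divides c eq)

  private
    along : ∀ {x y} → x ≡ y → + p ∣ x → + p ∣ y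
    along = subst (+ p ∣_)

  ≡⇒≋ : ∀ {a b} → a ≡ b → a ≋ b
  ≡⇒≋ {a} refl = ≋-by 0ℤ (ℤP.+-inverseʳ a)

  ≋-refl : ∀ {a} → a ≋ a
  ≋-refl = ≡⇒≋ refl

  ≋-sym : ∀ {a b} → a ≋ b → b ≋ a
  ≋-sym {a} {b} (congruent ab) = congruent (along (flip a b) (ℤD.∣m⇒∣-m ab))
    where flip : ∀ a b → - (a - b) ≡ b - a
          flip = solve-∀

  ≋-trans : ∀ {a b c} → a ≋ b → b ≋ c → a ≋ c
  ≋-trans {a} {b} {c} (congruent ab) (congruent bc) =
    congruent (along (chain a b c) (ℤD.∣m∣n⇒∣m+n ab bc))
    where chain : ∀ a b c → a - b + (b - c) ≡ a - c
          chain = solve-∀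

  +-cong : ∀ {a b c d} → a ≋ b → c ≋ d → a + c ≋ b + d
  +-cong {a} {b} {c} {d} (congruent ab) (congruent cd) =
    congruent (along (regroup a b c d) (ℤD.∣m∣n⇒∣m+n ab cd))
    where regroup : ∀ a b c d → a - b + (c - d) ≡ a + c - (b + d)
          regroup = solve-∀

  -‿cong : ∀ {a b} → a ≋ b → - a ≋ - b
  -‿cong {a} {b} (congruent ab) = congruent (along (negate a b) (ℤD.∣m⇒∣-m ab))
    where negate : ∀ a b → - (a - b) ≡ - a - - b
          negate = solve-∀

  *-cong : ∀ {a b c d} → a ≋ b → c ≋ d → a * c ≋ b * d
  *-cong {a} {b} {c} {d} (congruent ab) (congruent cd) =
    congruent (along (expand a b c d)
                     (ℤD.∣m∣n⇒∣m+n (ℤD.∣n⇒∣m*n a cd) (ℤD.∣m⇒∣m*n d ab)))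
    where expand : ∀ a b c d → a * (c - d) + (a - b) * d ≡ a * c - b * d
          expand = solve-∀

  ≋-setoid : Setoid 0ℓ 0ℓ
  ≋-setoid = record
    { Carrier = ℤ ; _≈_ = _≋_
    ; isEquivalence = record { refl = ≋-refl ; sym = ≋-sym ; trans = ≋-trans } }

  module ≋-Reasoning = SetoidReasoning ≋-setoid

  multiple≋0 : ∀ c → + p * c ≋ 0ℤ
  multiple≋0 c = ≋-by c (trans (ℤP.+-identityʳ (+ p * c)) (ℤP.*-comm (+ p) c))

  ∣⇒≋0 : ∀ {a} → + p ∣ a → a ≋ 0ℤ
  ∣⇒≋0 {a} p∣a = congruent (along (sym (ℤP.+-identityʳ a)) p∣a)

  ≋0⇒∣ : ∀ {a} → a ≋ 0ℤ → + p ∣ a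
  ≋0⇒∣ {a} (congruent p∣a) = along (ℤP.+-identityʳ a) p∣a

  ℕ∣⇒≋0 : ∀ {n} → p ℕD.∣ n → + n ≋ 0ℤ
  ℕ∣⇒≋0 = ∣⇒≋0 ∘ ∣ᵤ⇒∣

  below-p : ∀ n → n < p → + n ≋ 0ℤ → n ≡ 0
  below-p zero _ _ = refl
  below-p (suc n) n<p n≋0 = contradiction (ℕD.∣⇒≤ (∣⇒∣ᵤ (≋0⇒∣ n≋0))) (ℕP.<⇒≱ n<p)

  %ℕ-≋ : ∀ z {a} → z %ℕ p ≡ a → z ≋ + a
  %ℕ-≋ z {a} z%p≡a = ≋-by (z /ℕ p) (begin
    z - + a                         ≡⟨ cong (_- + a) (a≡a%ℕn+[a/ℕn]*n z p) ⟩
    + (z %ℕ p) + z /ℕ p * + p - + a ≡⟨ cong (λ r → + r + z /ℕ p * + p - + a) z%p≡a ⟩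
    + a + z /ℕ p * + p - + a        ≡⟨ cancel (+ a) (z /ℕ p * + p) ⟩
    z /ℕ p * + p ∎)
    where
    open ≡-Reasoning
    cancel : ∀ a y → a + y - a ≡ y
    cancel = solve-∀

  exact-division : ∀ Q → (Q * + p) /ℕ p ≡ Q
  exact-division Q = sym (ℤP.*-cancelʳ-≡ Q (N /ℕ p) (+ p) (sym (begin
    N /ℕ p * + p                ≡⟨ sym (ℤP.+-identityˡ _) ⟩
    + 0 + N /ℕ p * + p          ≡⟨ cong (λ r → + r + N /ℕ p * + p) (sym remainder-zero) ⟩
    + (N %ℕ p) + N /ℕ p * + p   ≡⟨ sym (a≡a%ℕn+[a/ℕn]*n N p) ⟩
    N ∎)))
    where
    open ≡-Reasoning
    N : ℤ
    N = Q * + p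
    N≋0 : N ≋ 0ℤ
    N≋0 = ≋-trans (≡⇒≋ (ℤP.*-comm Q (+ p))) (multiple≋0 Q)
    remainder-zero : N %ℕ p ≡ 0
    remainder-zero = below-p (N %ℕ p) (n%ℕd<d N p) (≋-trans (≋-sym (%ℕ-≋ N refl)) N≋0)

  Σ-≋ : ∀ n {f g : ℕ → ℤ} → (∀ i → i < n → f i ≋ g i) → Σ n f ≋ Σ n g
  Σ-≋ zero _ = ≋-refl
  Σ-≋ (suc n) f≋g = +-cong (f≋g 0 (s≤s z≤n)) (Σ-≋ n (λ i i<n → f≋g (suc i) (s≤s i<n)))

  Σ-≋0 : ∀ n {f : ℕ → ℤ} → (∀ i → i < n → f i ≋ 0ℤ) → Σ n f ≋ 0ℤ
  Σ-≋0 n f≋0 = ≋-trans (Σ-≋ n f≋0) (≡⇒≋ (trans (Σ-const n 0ℤ) (ℤP.*-zeroʳ (+ n))))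

  Σ-single : ∀ n (f : ℕ → ℤ) j → j < n →
             (∀ i → i < n → i ≢ j → f i ≋ 0ℤ) → Σ n f ≋ f j
  Σ-single (suc n) f zero _ others = begin
    f 0 + Σ n (f ∘ suc)
      ≈⟨ +-cong (≋-refl {f 0}) (Σ-≋0 n (λ i i<n → others (suc i) (s≤s i<n) λ ())) ⟩
    f 0 + 0ℤ
      ≡⟨ ℤP.+-identityʳ (f 0) ⟩
    f 0 ∎
    where open ≋-Reasoning
  Σ-single (suc n) f (suc j) (s≤s j<n) others = begin
    f 0 + Σ n (f ∘ suc)
      ≈⟨ +-cong (others 0 (s≤s z≤n) λ ())
                (Σ-single n (f ∘ suc) j j<n
                   λ i i<n i≢j → others (suc i) (s≤s i<n) (i≢j ∘ ℕP.suc-injective)) ⟩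
    0ℤ + f (suc j)
      ≡⟨ ℤP.+-identityˡ (f (suc j)) ⟩
    f (suc j) ∎
    where open ≋-Reasoning

  listSum-filter : ∀ {A : Set} {P : Pred A 0ℓ} (P? : Decidable P) (w : A → ℤ) →
                   (∀ x → P x → w x ≋ 0ℤ) →
                   ∀ xs → listSum w xs ≋ listSum w (filter (∁? P?) xs)
  listSum-filter P? w vanish [] = ≋-refl
  listSum-filter P? w vanish (x ∷ xs) with P? x
  ... | yes Px = ≋-trans (+-cong (vanish x Px) (listSum-filter P? w vanish xs))
                         (≡⇒≋ (ℤP.+-identityˡ _))
  ... | no _ = +-cong (≋-refl {w x}) (listSum-filter P? w vanish xs)

module PrimeModulus (n : ℕ) (p-prime : Prime (2 ℕ.+ n)) where

  p q : ℕ
  p = 2 ℕ.+ n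
  q = suc n

  open Congruence p public

  cancel : ∀ {k a b} → 0 < k → k < p → + k * a ≋ + k * b → a ≋ b
  cancel {k@(suc _)} {a} {b} _ k<p (congruent p∣ka-kb)
    with euclidsLemma k ℤ.∣ a - b ∣ p-prime
           (subst (p ℕD.∣_) (ℤP.abs-* (+ k) (a - b))
             (∣⇒∣ᵤ (subst (+ p ∣_) (factor (+ k) a b) p∣ka-kb)))
    where
    factor : ∀ k a b → k * a - k * b ≡ k * (a - b)
    factor = solve-∀
  ... | inj₁ p∣k = contradiction (ℕD.∣⇒≤ p∣k) (ℕP.<⇒≱ k<p)
  ... | inj₂ p∣a-b = congruent (∣ᵤ⇒∣ p∣a-b)

  -- p divides C(p, j + 1) for j < q: (j + 1) C(p, j + 1) = p C(q, j) by absorption.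
  prime∣binomial : ∀ j → j < q → p ℕD.∣ (p C suc j)
  prime∣binomial j j<q
    with euclidsLemma (suc j) (p C suc j) p-prime
           (ℕD.divides (q C j) (trans (absorption q j) (ℕP.*-comm p (q C j))))
  ... | inj₁ p∣j+1 = contradiction (ℕD.∣⇒≤ p∣j+1) (ℕP.<⇒≱ (s≤s j<q))
  ... | inj₂ p∣C = p∣C

  -- C(p - 1, i) ≡ (-1)^i, from Pascal's rule C(q, i) + C(q, i + 1) = C(p, i + 1).
  binomial-alternating : ∀ i → i ≤ q → + (q C i) ≋ (-1ℤ) ^ i
  binomial-alternating zero _ = ≋-refl
  binomial-alternating (suc i) i<q = begin
    + (q C suc i)                    ≡⟨ pascal ⟩
    + (p C suc i) - + (q C i)        ≈⟨ +-cong (ℕ∣⇒≋0 (prime∣binomial i i<q))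
                                               (-‿cong (binomial-alternating i (ℕP.<⇒≤ i<q))) ⟩
    0ℤ - (-1ℤ) ^ i                   ≡⟨ negate ((-1ℤ) ^ i) ⟩
    (-1ℤ) ^ suc i ∎
    where
    open ≋-Reasoning
    shift : ∀ a b → b ≡ a + b - a
    shift = solve-∀
    negate : ∀ s → 0ℤ - s ≡ -1ℤ * s
    negate = solve-∀
    pascal : + (q C suc i) ≡ + (p C suc i) - + (q C i)
    pascal = trans (shift (+ (q C i)) (+ (q C suc i)))
      (cong (_- + (q C i)) (trans (sym (ℤP.pos-+ (q C i) (q C suc i)))
                                  (cong +_ (nCk+nC[k+1]≡[n+1]C[k+1] q i))))

  middle : ℤ → ℤ
  middle X = Σ q (λ j → + (p C suc j) * X ^ suc j)

  binomial-prime : ∀ X → (1ℤ + X) ^ p ≡ 1ℤ + (middle X + X ^ p)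
  binomial-prime X = begin
    (1ℤ + X) ^ p
      ≡⟨ binomial p X ⟩
    1ℤ + Σ p (λ j → + (p C suc j) * X ^ suc j)
      ≡⟨ cong (λ y → 1ℤ + y) (Σ-last q (λ j → + (p C suc j) * X ^ suc j)) ⟩
    1ℤ + (middle X + + (p C p) * X ^ p)
      ≡⟨ cong (λ c → 1ℤ + (middle X + + c * X ^ p)) (nCn≡1 p) ⟩
    1ℤ + (middle X + + 1 * X ^ p)
      ≡⟨ cong (λ y → 1ℤ + (middle X + y)) (ℤP.*-identityˡ (X ^ p)) ⟩
    1ℤ + (middle X + X ^ p) ∎
    where open ≡-Reasoning

  middle≋0 : ∀ X → middle X ≋ 0ℤ
  middle≋0 X = Σ-≋0 q λ j j<q → begin
    + (p C suc j) * X ^ suc j  ≈⟨ *-cong (ℕ∣⇒≋0 (prime∣binomial j j<q)) (≋-refl {X ^ suc j}) ⟩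
    0ℤ * X ^ suc j             ≡⟨ ℤP.*-zeroˡ (X ^ suc j) ⟩
    0ℤ ∎
    where open ≋-Reasoning

  fermat : ∀ (x : ℕ) → (+ x) ^ p ≋ + x
  fermat zero = ≡⇒≋ (ℤP.*-zeroˡ (0ℤ ^ q))
  fermat (suc x) = begin
    (1ℤ + + x) ^ p                  ≡⟨ binomial-prime (+ x) ⟩
    1ℤ + (middle (+ x) + (+ x) ^ p) ≈⟨ +-cong (≋-refl {1ℤ}) (+-cong (middle≋0 (+ x)) (fermat x)) ⟩
    1ℤ + (0ℤ + + x)                 ≡⟨ cong (λ y → 1ℤ + y) (ℤP.+-identityˡ (+ x)) ⟩
    1ℤ + + x ∎
    where open ≋-Reasoning

  fermat-unit : ∀ (x : ℕ) → 0 < x → x < p → (+ x) ^ q ≋ 1ℤ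
  fermat-unit x 0<x x<p =
    cancel 0<x x<p (≋-trans (fermat x) (≡⇒≋ (sym (ℤP.*-identityʳ (+ x)))))

  S : ℕ → ℤ
  S j = Σ p (λ x → (+ x) ^ j)

  power-difference : ∀ j X →
    (1ℤ + X) ^ suc j - X ^ suc j ≡ Σ (suc j) (λ i → + (suc j C i) * X ^ i)
  power-difference j X = begin
    (1ℤ + X) ^ suc j - X ^ suc j            ≡⟨ cong (_- X ^ suc j) (binomial (suc j) X) ⟩
    Σ (suc (suc j)) g - X ^ suc j           ≡⟨ cong (_- X ^ suc j) (Σ-last (suc j) g) ⟩
    Σ (suc j) g + g (suc j) - X ^ suc j     ≡⟨ cong (λ c → Σ (suc j) g + + c * X ^ suc j - X ^ suc j)
                                                     (nCn≡1 (suc j)) ⟩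
    Σ (suc j) g + + 1 * X ^ suc j - X ^ suc j ≡⟨ drop (Σ (suc j) g) (X ^ suc j) ⟩
    Σ (suc j) g ∎
    where
    open ≡-Reasoning
    g : ℕ → ℤ
    g i = + (suc j C i) * X ^ i
    drop : ∀ s y → s + + 1 * y - y ≡ s
    drop = solve-∀

  -- Summing the differences over x < p telescopes:
  --   Σ_{i≤j} C(j + 1, i) S i = p^(j+1).
  power-sum-recurrence : ∀ j → Σ (suc j) (λ i → + (suc j C i) * S i) ≡ (+ p) ^ suc j
  power-sum-recurrence j = begin
    Σ (suc j) (λ i → + (suc j C i) * S i)
      ≡⟨ Σ-cong (suc j) (λ i _ → sym (Σ-* p (+ (suc j C i)) (λ x → (+ x) ^ i))) ⟩
    Σ (suc j) (λ i → Σ p (λ x → + (suc j C i) * (+ x) ^ i))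
      ≡⟨ Σ-swap (suc j) p (λ i x → + (suc j C i) * (+ x) ^ i) ⟩
    Σ p (λ x → Σ (suc j) (λ i → + (suc j C i) * (+ x) ^ i))
      ≡⟨ Σ-cong p (λ x _ → sym (power-difference j (+ x))) ⟩
    Σ p (λ x → (+ suc x) ^ suc j - (+ x) ^ suc j)
      ≡⟨ Σ-telescope p (λ x → (+ x) ^ suc j) ⟩
    (+ p) ^ suc j - 0ℤ ^ suc j
      ≡⟨ cong (λ z → (+ p) ^ suc j - z) (ℤP.*-zeroˡ (0ℤ ^ j)) ⟩
    (+ p) ^ suc j - 0ℤ
      ≡⟨ ℤP.+-identityʳ ((+ p) ^ suc j) ⟩
    (+ p) ^ suc j ∎
    where open ≡-Reasoning

  -- S j ≡ 0 for j < p - 1, by strong induction: the top term (j + 1) S j of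
  -- the recurrence is ≡ p^(j+1) ≡ 0 modulo the lower ones, and 0 < j + 1 < p.
  power-sum-vanishes : ∀ j → suc j < p → S j ≋ 0ℤ
  power-sum-vanishes = <-rec (λ j → suc j < p → S j ≋ 0ℤ) step
    where
    step : ∀ j → (∀ {i} → i < j → suc i < p → S i ≋ 0ℤ) → suc j < p → S j ≋ 0ℤ
    step j below j+1<p = cancel (s≤s z≤n) j+1<p (begin
      + suc j * S j                ≡⟨ cong (λ c → + c * S j) (sym (C-pred j)) ⟩
      h j                          ≡⟨ isolate (Σ j h) (h j) ⟩
      Σ j h + h j - Σ j h          ≡⟨ cong (_- Σ j h) (sym (Σ-last j h)) ⟩
      Σ (suc j) h - Σ j h          ≈⟨ +-cong (≡⇒≋ (power-sum-recurrence j)) (-‿cong lower≋0) ⟩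
      + p * (+ p) ^ j - 0ℤ         ≈⟨ +-cong (multiple≋0 ((+ p) ^ j)) (≋-refl { - 0ℤ}) ⟩
      0ℤ                           ≡⟨ sym (ℤP.*-zeroʳ (+ suc j)) ⟩
      + suc j * 0ℤ ∎)
      where
      open ≋-Reasoning
      h : ℕ → ℤ
      h i = + (suc j C i) * S i
      isolate : ∀ s t → t ≡ s + t - s
      isolate = solve-∀
      lower≋0 : Σ j h ≋ 0ℤ
      lower≋0 = Σ-≋0 j λ i i<j → begin
        + (suc j C i) * S i
          ≈⟨ *-cong (≋-refl {+ (suc j C i)}) (below i<j (ℕP.<-trans (s≤s i<j) j+1<p)) ⟩
        + (suc j C i) * 0ℤ
          ≡⟨ ℤP.*-zeroʳ (+ (suc j C i)) ⟩
        0ℤ ∎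

  -- S (p - 1) ≡ -1: all p - 1 non-zero terms are ≡ 1 by Fermat.
  power-sum-top : S q ≋ -1ℤ
  power-sum-top = begin
    0ℤ ^ q + Σ q (λ x → (+ suc x) ^ q) ≈⟨ +-cong (≡⇒≋ (ℤP.*-zeroˡ (0ℤ ^ n)))
                                            (Σ-≋ q λ x x<q → fermat-unit (suc x) (s≤s z≤n) (s≤s x<q)) ⟩
    0ℤ + Σ q (λ _ → 1ℤ)                ≡⟨ cong (λ y → 0ℤ + y) (Σ-const q 1ℤ) ⟩
    0ℤ + + q * 1ℤ                      ≈⟨ ≋-by 1ℤ (rearrange (+ q)) ⟩
    -1ℤ ∎
    where
    open ≋-Reasoning
    rearrange : ∀ Q → 0ℤ + Q * 1ℤ - -1ℤ ≡ 1ℤ * (1ℤ + Q)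
    rearrange = solve-∀

  -- Periodicity: S (p + t) ≡ S (t + 1), since x^p ≡ x.
  power-sum-period : ∀ t → S (p ℕ.+ t) ≋ S (suc t)
  power-sum-period t = Σ-≋ p λ x _ → begin
    (+ x) ^ (p ℕ.+ t)      ≡⟨ ℤP.^-distribˡ-+-* (+ x) p t ⟩
    (+ x) ^ p * (+ x) ^ t  ≈⟨ *-cong (fermat x) (≋-refl {(+ x) ^ t}) ⟩
    + x * (+ x) ^ t ∎
    where open ≋-Reasoning

  power-sum-off-diagonal : ∀ k → k ≢ q → k < q ℕ.+ q → S k ≋ 0ℤ
  power-sum-off-diagonal k k≢q k<2q with ℕP.<-cmp k q
  ... | tri< k<q _ _ = power-sum-vanishes k (s≤s k<q)
  ... | tri≈ _ k≡q _ = contradiction k≡q k≢q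
  ... | tri> _ _ q<k = begin
    S k              ≡⟨ cong S (sym p+t≡k) ⟩
    S (p ℕ.+ t)      ≈⟨ power-sum-period t ⟩
    S (suc t)        ≈⟨ power-sum-vanishes (suc t) t+2<p ⟩
    0ℤ ∎
    where
    open ≋-Reasoning
    t : ℕ
    t = k ∸ p
    p+t≡k : p ℕ.+ t ≡ k
    p+t≡k = ℕP.m+[n∸m]≡n q<k
    t+2<p : suc (suc t) < p
    t+2<p = s≤s (ℕP.+-cancelˡ-≤ q (suc (suc t)) q
              (subst (ℕ._≤ q ℕ.+ q) (shuffle t)
                     (subst (λ k → suc k ≤ q ℕ.+ q) (sym p+t≡k) k<2q)))
      where
      shuffle : ∀ t → suc (p ℕ.+ t) ≡ q ℕ.+ suc (suc t)
      shuffle t = sym (trans (ℕP.+-suc q (suc t)) (cong suc (ℕP.+-suc q t)))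

parity : ∀ m → (∃ λ t → m ≡ t ℕ.+ t) ⊎ (∃ λ t → m ≡ suc (t ℕ.+ t))
parity zero = inj₁ (0 , refl)
parity (suc m) with parity m
... | inj₁ (t , m≡2t) = inj₂ (t , cong suc m≡2t)
... | inj₂ (t , m≡2t+1) = inj₁ (suc t , cong suc (trans m≡2t+1 (sym (ℕP.+-suc t t))))

minus-one-even : ∀ t → (-1ℤ) ^ (t ℕ.+ t) ≡ 1ℤ
minus-one-even zero = refl
minus-one-even (suc t) rewrite ℕP.+-suc t t | minus-one-even t = refl

negation-power : ∀ m X → (- X) ^ m ≡ (-1ℤ) ^ m * X ^ m
negation-power zero X = refl
negation-power (suc m) X = trans (cong (- X *_) (negation-power m X)) (regroup X ((-1ℤ) ^ m) (X ^ m))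
  where
  regroup : ∀ x s y → - x * (s * y) ≡ -1ℤ * s * (x * y)
  regroup = solve-∀

module OddPrime (n : ℕ) (p-prime : Prime (3 ℕ.+ n)) where

  open PrimeModulus (suc n) p-prime public

  -- p is odd (an even p would be divisible by 2, hence equal to 2), so (-1)^p = -1.
  minus-one-power : (-1ℤ) ^ p ≡ -1ℤ
  minus-one-power with parity p
  ... | inj₂ (t , p≡2t+1) = trans (cong (-1ℤ ^_) p≡2t+1) (cong (-1ℤ *_) (minus-one-even t))
  ... | inj₁ (t , p≡2t) with prime⇒irreducible p-prime (ℕD.divides t (trans p≡2t (twice t)))
    where
    twice : ∀ t → t ℕ.+ t ≡ t ℕ.* 2
    twice t = trans (cong (t ℕ.+_) (sym (ℕP.+-identityʳ t))) (ℕP.*-comm 2 t)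
  ... | inj₁ ()
  ... | inj₂ ()

  e : ℕ → ℕ
  e j = (p C suc j) ℕ./ p

  e-spec : ∀ j → j < q → p C suc j ≡ e j ℕ.* p
  e-spec j j<q = sym (ℕDM.m/n*n≡m (prime∣binomial j j<q))

  -- φ(X) = Σ_{j<p-1} e_j (-X)^(j+1): the binomial expansion of (1 - X)^p loses
  -- its first term to the -1 and its last term to X^p (p odd); the rest is
  -- p times the claimed sum.
  φ-expansion : ∀ X → φ p X ≡ Σ q (λ j → + e j * (- X) ^ suc j)
  φ-expansion X = trans (cong (_/ℕ p) numerator) (exact-division E)
    where
    E : ℤ
    E = Σ q (λ j → + e j * (- X) ^ suc j)
    cancel-ends : ∀ M Y → 1ℤ + (M + -1ℤ * Y) - 1ℤ + Y ≡ M
    cancel-ends = solve-∀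
    factor-p : ∀ j → j < q → + (p C suc j) * (- X) ^ suc j ≡ + p * (+ e j * (- X) ^ suc j)
    factor-p j j<q = begin
      + (p C suc j) * (- X) ^ suc j       ≡⟨ cong (λ c → + c * (- X) ^ suc j) (e-spec j j<q) ⟩
      + (e j ℕ.* p) * (- X) ^ suc j       ≡⟨ cong (_* (- X) ^ suc j) (ℤP.pos-* (e j) p) ⟩
      + e j * + p * (- X) ^ suc j         ≡⟨ regroup (+ e j) (+ p) ((- X) ^ suc j) ⟩
      + p * (+ e j * (- X) ^ suc j) ∎
      where
      open ≡-Reasoning
      regroup : ∀ a b c → a * b * c ≡ b * (a * c)
      regroup = solve-∀
    numerator : (1ℤ - X) ^ p - 1ℤ + X ^ p ≡ E * + p
    numerator = begin
      (1ℤ - X) ^ p - 1ℤ + X ^ p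
        ≡⟨ cong (λ z → z - 1ℤ + X ^ p) (binomial-prime (- X)) ⟩
      1ℤ + (middle (- X) + (- X) ^ p) - 1ℤ + X ^ p
        ≡⟨ cong (λ z → 1ℤ + (middle (- X) + z) - 1ℤ + X ^ p)
                (trans (negation-power p X) (cong (_* X ^ p) minus-one-power)) ⟩
      1ℤ + (middle (- X) + -1ℤ * X ^ p) - 1ℤ + X ^ p
        ≡⟨ cancel-ends (middle (- X)) (X ^ p) ⟩
      middle (- X)
        ≡⟨ Σ-cong q factor-p ⟩
      Σ q (λ j → + p * (+ e j * (- X) ^ suc j))
        ≡⟨ Σ-* q (+ p) (λ j → + e j * (- X) ^ suc j) ⟩
      + p * E
        ≡⟨ ℤP.*-comm (+ p) E ⟩
      E * + p ∎
      where open ≡-Reasoning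

  c : ℕ → ℤ
  c j = + e j * (-1ℤ) ^ suc j

  φ-times-power : ∀ m X → φ p X * X ^ m ≡ Σ q (λ j → c j * X ^ (suc j ℕ.+ m))
  φ-times-power m X = begin
    φ p X * X ^ m
      ≡⟨ cong (_* X ^ m) (φ-expansion X) ⟩
    Σ q (λ j → + e j * (- X) ^ suc j) * X ^ m
      ≡⟨ ℤP.*-comm _ (X ^ m) ⟩
    X ^ m * Σ q (λ j → + e j * (- X) ^ suc j)
      ≡⟨ sym (Σ-* q (X ^ m) (λ j → + e j * (- X) ^ suc j)) ⟩
    Σ q (λ j → X ^ m * (+ e j * (- X) ^ suc j))
      ≡⟨ Σ-cong q (λ j _ → term j) ⟩
    Σ q (λ j → c j * X ^ (suc j ℕ.+ m)) ∎
    where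
    open ≡-Reasoning
    regroup : ∀ y a s z → y * (a * (s * z)) ≡ a * s * (z * y)
    regroup = solve-∀
    term : ∀ j → X ^ m * (+ e j * (- X) ^ suc j) ≡ c j * X ^ (suc j ℕ.+ m)
    term j = begin
      X ^ m * (+ e j * (- X) ^ suc j)
        ≡⟨ cong (λ z → X ^ m * (+ e j * z)) (negation-power (suc j) X) ⟩
      X ^ m * (+ e j * ((-1ℤ) ^ suc j * X ^ suc j))
        ≡⟨ regroup (X ^ m) (+ e j) ((-1ℤ) ^ suc j) (X ^ suc j) ⟩
      c j * (X ^ suc j * X ^ m)
        ≡⟨ cong (c j *_) (sym (ℤP.^-distribˡ-+-* X (suc j) m)) ⟩
      c j * X ^ (suc j ℕ.+ m) ∎

  φ-moment : ∀ m → Σ p (λ x → φ p (+ x) * (+ x) ^ m) ≡ Σ q (λ j → c j * S (suc j ℕ.+ m))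
  φ-moment m = begin
    Σ p (λ x → φ p (+ x) * (+ x) ^ m)
      ≡⟨ Σ-cong p (λ x _ → φ-times-power m (+ x)) ⟩
    Σ p (λ x → Σ q (λ j → c j * (+ x) ^ (suc j ℕ.+ m)))
      ≡⟨ Σ-swap p q (λ x j → c j * (+ x) ^ (suc j ℕ.+ m)) ⟩
    Σ q (λ j → Σ p (λ x → c j * (+ x) ^ (suc j ℕ.+ m)))
      ≡⟨ Σ-cong q (λ j _ → Σ-* p (c j) (λ x → (+ x) ^ (suc j ℕ.+ m))) ⟩
    Σ q (λ j → c j * S (suc j ℕ.+ m)) ∎
    where open ≡-Reasoning

  e-absorption : ∀ j → j < q → suc j ℕ.* e j ≡ q C j
  e-absorption j j<q = ℕP.*-cancelʳ-≡ (suc j ℕ.* e j) (q C j) p (begin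
    suc j ℕ.* e j ℕ.* p     ≡⟨ ℕP.*-assoc (suc j) (e j) p ⟩
    suc j ℕ.* (e j ℕ.* p)   ≡⟨ cong (suc j ℕ.*_) (sym (e-spec j j<q)) ⟩
    suc j ℕ.* (p C suc j)   ≡⟨ absorption q j ⟩
    p ℕ.* (q C j)           ≡⟨ ℕP.*-comm p (q C j) ⟩
    (q C j) ℕ.* p ∎)
    where open ≡-Reasoning

  -- (j + 1) c_j ≡ -1, i.e. C(p, k)/p ≡ (-1)^(k-1)/k, since
  -- (j + 1) e_j = C(p - 1, j) ≡ (-1)^j.
  coefficient-congruence : ∀ j → j < q → + suc j * c j ≋ -1ℤ
  coefficient-congruence j j<q = begin
    + suc j * (+ e j * (-1ℤ * s))        ≡⟨ regroup (+ suc j) (+ e j) (-1ℤ * s) ⟩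
    + suc j * + e j * (-1ℤ * s)          ≡⟨ cong (_* (-1ℤ * s)) (sym (ℤP.pos-* (suc j) (e j))) ⟩
    + (suc j ℕ.* e j) * (-1ℤ * s)        ≡⟨ cong (λ k → + k * (-1ℤ * s)) (e-absorption j j<q) ⟩
    + (q C j) * (-1ℤ * s)                ≈⟨ *-cong (binomial-alternating j (ℕP.<⇒≤ j<q))
                                                   (≋-refl { -1ℤ * s}) ⟩
    s * (-1ℤ * s)                        ≡⟨ square s ⟩
    -1ℤ * (s * s)                        ≡⟨ cong (-1ℤ *_) s²≡1 ⟩
    -1ℤ ∎
    where
    open ≋-Reasoning
    s : ℤ
    s = (-1ℤ) ^ j
    regroup : ∀ a b c → a * (b * c) ≡ a * b * c
    regroup = solve-∀
    square : ∀ s → s * (-1ℤ * s) ≡ -1ℤ * (s * s)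
    square = solve-∀
    s²≡1 : s * s ≡ 1ℤ
    s²≡1 = trans (sym (ℤP.^-distribˡ-+-* -1ℤ j j)) (minus-one-even j)

  -- For m < p - 1, the index j₀ = p - 2 - m is the one with j₀ + 1 + m = p - 1.
  top-index : ℕ → ℕ
  top-index m = q ∸ suc m

  top-index-spec : ∀ m → m < q → suc (top-index m) ℕ.+ m ≡ q
  top-index-spec m m<q = trans (sym (ℕP.+-suc (top-index m) m)) (ℕP.m∸n+n≡m m<q)

  top-index<q : ∀ m → m < q → top-index m < q
  top-index<q m m<q = subst (suc (top-index m) ≤_) (top-index-spec m m<q) (ℕP.m≤m+n _ m)

  -- In Σ_j c_j S(j + 1 + m) only the term j₀ survives, and S(p - 1) ≡ -1:
  --   Σ_{x<p} φ(x) x^m ≡ -c_{j₀}.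
  φ-moment-top : ∀ m → m < q → Σ p (λ x → φ p (+ x) * (+ x) ^ m) ≋ c (top-index m) * -1ℤ
  φ-moment-top m m<q = begin
    Σ p (λ x → φ p (+ x) * (+ x) ^ m)
      ≡⟨ φ-moment m ⟩
    Σ q (λ j → c j * S (suc j ℕ.+ m))
      ≈⟨ Σ-single q (λ j → c j * S (suc j ℕ.+ m)) j₀ (top-index<q m m<q) others ⟩
    c j₀ * S (suc j₀ ℕ.+ m)
      ≡⟨ cong (λ k → c j₀ * S k) (top-index-spec m m<q) ⟩
    c j₀ * S q
      ≈⟨ *-cong (≋-refl {c j₀}) power-sum-top ⟩
    c j₀ * -1ℤ ∎
    where
    open ≋-Reasoning
    j₀ : ℕ
    j₀ = top-index m
    others : ∀ j → j < q → j ≢ j₀ → c j * S (suc j ℕ.+ m) ≋ 0ℤ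
    others j j<q j≢j₀ =
      ≋-trans (*-cong (≋-refl {c j}) (power-sum-off-diagonal (suc j ℕ.+ m) off below))
              (≡⇒≋ (ℤP.*-zeroʳ (c j)))
      where
      off : suc j ℕ.+ m ≢ q
      off eq = j≢j₀ (ℕP.suc-injective (ℕP.+-cancelʳ-≡ m (suc j) (suc j₀)
                                         (trans eq (sym (top-index-spec m m<q)))))
      below : suc j ℕ.+ m < q ℕ.+ q
      below = subst (ℕ._≤ q ℕ.+ q) (ℕP.+-suc (suc j) m) (ℕP.+-mono-≤ j<q m<q)

  -- (m + 1) c_{j₀} ≡ 1, because m + 1 = p - (j₀ + 1) and (j₀ + 1) c_{j₀} ≡ -1.
  top-coefficient : ∀ m → m < q → + suc m * c (top-index m) ≋ 1ℤ
  top-coefficient m m<q = begin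
    + suc m * c j₀                       ≡⟨ cong (_* c j₀) m+1≡p-[j₀+1] ⟩
    (+ p - + suc j₀) * c j₀              ≡⟨ expand (+ p) (+ suc j₀) (c j₀) ⟩
    + p * c j₀ + - (+ suc j₀ * c j₀)     ≈⟨ +-cong (multiple≋0 (c j₀))
                                                   (-‿cong (coefficient-congruence j₀ (top-index<q m m<q))) ⟩
    0ℤ + - -1ℤ                           ≡⟨⟩
    1ℤ ∎
    where
    open ≋-Reasoning
    j₀ : ℕ
    j₀ = top-index m
    expand : ∀ P J C → (P - J) * C ≡ P * C + - (J * C)
    expand = solve-∀
    add-sub : ∀ a b → a ≡ a + b - b
    add-sub = solve-∀
    m+1≡p-[j₀+1] : + suc m ≡ + p - + suc j₀
    m+1≡p-[j₀+1] = trans (add-sub (+ suc m) (+ suc j₀))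
      (cong (_- + suc j₀) (trans (sym (ℤP.pos-+ (suc m) (suc j₀)))
        (cong +_ (trans (ℕP.+-comm (suc m) (suc j₀))
                        (trans (ℕP.+-suc (suc j₀) m) (cong suc (top-index-spec m m<q)))))))

  -- The moment congruence: for 0 ≤ m < p - 1 and every integer A,
  --   (m + 1) Σ_{x<p} (φ(x) - A) x^m ≡ -1,
  -- since Σ_{x<p} φ(x) x^m ≡ -c_{j₀}, (m + 1) c_{j₀} ≡ 1 and S m ≡ 0.
  moment : ∀ m → m < q → ∀ A → + suc m * Σ p (λ x → (φ p (+ x) - A) * (+ x) ^ m) + 1ℤ ≋ 0ℤ
  moment m m<q A = begin
    + suc m * Σ p (λ x → (φ p (+ x) - A) * (+ x) ^ m) + 1ℤ
      ≡⟨ cong (λ t → + suc m * t + 1ℤ) split ⟩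
    + suc m * (Σ p (λ x → φ p (+ x) * (+ x) ^ m) + - A * S m) + 1ℤ
      ≈⟨ +-cong (*-cong (≋-refl {+ suc m}) (+-cong (φ-moment-top m m<q)
                  (*-cong (≋-refl { - A}) (power-sum-vanishes m (s≤s m<q))))) (≋-refl {1ℤ}) ⟩
    + suc m * (c j₀ * -1ℤ + - A * 0ℤ) + 1ℤ
      ≡⟨ simplify (+ suc m) (c j₀) A ⟩
    - (+ suc m * c j₀) + 1ℤ
      ≈⟨ +-cong (-‿cong (top-coefficient m m<q)) (≋-refl {1ℤ}) ⟩
    -1ℤ + 1ℤ
      ≡⟨⟩
    0ℤ ∎
    where
    open ≋-Reasoning
    j₀ : ℕ
    j₀ = top-index m
    simplify : ∀ M C A → M * (C * -1ℤ + - A * 0ℤ) + 1ℤ ≡ - (M * C) + 1ℤ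
    simplify = solve-∀
    distribute : ∀ a A y → (a - A) * y ≡ a * y + - A * y
    distribute = solve-∀
    split : Σ p (λ x → (φ p (+ x) - A) * (+ x) ^ m)
            ≡ Σ p (λ x → φ p (+ x) * (+ x) ^ m) + - A * S m
    split = trans (Σ-cong p (λ x _ → distribute (φ p (+ x)) A ((+ x) ^ m)))
      (trans (Σ-+ p (λ x → φ p (+ x) * (+ x) ^ m) (λ x → - A * (+ x) ^ m))
        (cong (λ t → Σ p (λ x → φ p (+ x) * (+ x) ^ m) + t) (Σ-* p (- A) (λ x → (+ x) ^ m))))

  φ-zero : φ p 0ℤ ≡ 0ℤ
  φ-zero = cong (_/ℕ p) (cong₂ (λ u v → u - 1ℤ + v) (ℤP.^-zeroˡ p) (ℤP.*-zeroˡ (0ℤ ^ q)))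

  φ-one : φ p 1ℤ ≡ 0ℤ
  φ-one = cong (_/ℕ p) (cong₂ (λ u v → u - 1ℤ + v) (ℤP.*-zeroˡ (0ℤ ^ q)) (ℤP.^-zeroˡ p))

powerSum : {A : Set} → (A → ℤ) → (A → ℤ) → List A → ℕ → ℤ
powerSum w v L k = listSum (λ x → w x * v x ^ k) L

Recurrence : ℤ → ℤ → (ℕ → ℤ) → ℕ → Set
Recurrence s r T k = T (suc (suc k)) ≡ s * T (suc k) - r * T k

at-most-two-points : ∀ {A : Set} (w v : A → ℤ) (L : List A) → length L ≤ 2 →
                     ∃₂ λ s r → ∀ k → Recurrence s r (powerSum w v L) k
at-most-two-points w v [] _ = 0ℤ , 0ℤ , λ k → refl
at-most-two-points w v (x ∷ []) _ = v x , 0ℤ , λ k → one (w x) (v x) (v x ^ k)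
  where
  one : ∀ u a X → u * (a * (a * X)) + 0ℤ ≡ a * (u * (a * X) + 0ℤ) - 0ℤ * (u * X + 0ℤ)
  one = solve-∀
at-most-two-points w v (x ∷ y ∷ []) _ =
  v x + v y , v x * v y , λ k → two (w x) (v x) (v x ^ k) (w y) (v y) (v y ^ k)
  where
  two : ∀ u a X t b Y →
        u * (a * (a * X)) + (t * (b * (b * Y)) + 0ℤ)
        ≡ (a + b) * (u * (a * X) + (t * (b * Y) + 0ℤ)) - a * b * (u * X + (t * Y + 0ℤ))
  two = solve-∀
at-most-two-points w v (_ ∷ _ ∷ _ ∷ _) (s≤s (s≤s ()))

-- A power sum over the points 0, 1 and at most one further point y obeys, from
-- index 1 on (where the point 0 no longer contributes), the recurrence with
-- characteristic roots 1 and y.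
zero-one-and-one-more : ∀ {A : Set} (w v : A → ℤ) x₀ x₁ (L : List A) →
                        v x₀ ≡ 0ℤ → v x₁ ≡ 1ℤ → length L ≤ 1 →
                        ∃ λ y → ∀ k → Recurrence (1ℤ + y) y (powerSum w v (x₀ ∷ x₁ ∷ L)) (suc k)
zero-one-and-one-more w v x₀ x₁ [] v₀ v₁ _ = 0ℤ , recurrence
  where
  identity : ∀ u₀ u₁ Z O →
    u₀ * (0ℤ * (0ℤ * (0ℤ * Z))) + (u₁ * (1ℤ * (1ℤ * (1ℤ * O))) + 0ℤ)
    ≡ (1ℤ + 0ℤ) * (u₀ * (0ℤ * (0ℤ * Z)) + (u₁ * (1ℤ * (1ℤ * O)) + 0ℤ))
      - 0ℤ * (u₀ * (0ℤ * Z) + (u₁ * (1ℤ * O) + 0ℤ))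
  identity = solve-∀
  recurrence : ∀ k → Recurrence (1ℤ + 0ℤ) 0ℤ (powerSum w v (x₀ ∷ x₁ ∷ [])) (suc k)
  recurrence k rewrite v₀ | v₁ = identity (w x₀) (w x₁) (0ℤ ^ k) (1ℤ ^ k)
zero-one-and-one-more w v x₀ x₁ (y ∷ []) v₀ v₁ _ = v y , recurrence
  where
  identity : ∀ u₀ u₁ Z O u b Y →
    u₀ * (0ℤ * (0ℤ * (0ℤ * Z))) + (u₁ * (1ℤ * (1ℤ * (1ℤ * O))) + (u * (b * (b * (b * Y))) + 0ℤ))
    ≡ (1ℤ + b) * (u₀ * (0ℤ * (0ℤ * Z)) + (u₁ * (1ℤ * (1ℤ * O)) + (u * (b * (b * Y)) + 0ℤ)))
      - b * (u₀ * (0ℤ * Z) + (u₁ * (1ℤ * O) + (u * (b * Y) + 0ℤ)))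
  identity = solve-∀
  recurrence : ∀ k → Recurrence (1ℤ + v y) (v y) (powerSum w v (x₀ ∷ x₁ ∷ y ∷ [])) (suc k)
  recurrence k rewrite v₀ | v₁ = identity (w x₀) (w x₁) (0ℤ ^ k) (1ℤ ^ k) (w y) (v y) (v y ^ k)
zero-one-and-one-more w v x₀ x₁ (_ ∷ _ ∷ _) _ _ (s≤s ())

module Obstruction (p : ℕ) .{{_ : NonZero p}} where

  open Congruence p

  combination₂ : ∀ x y {a b} → a ≋ 0ℤ → b ≋ 0ℤ → x * a + y * b ≋ 0ℤ
  combination₂ x y {a} {b} a≋0 b≋0 = begin
    x * a + y * b   ≈⟨ +-cong (*-cong (≋-refl {x}) a≋0) (*-cong (≋-refl {y}) b≋0) ⟩
    x * 0ℤ + y * 0ℤ ≡⟨ cong₂ _+_ (ℤP.*-zeroʳ x) (ℤP.*-zeroʳ y) ⟩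
    0ℤ ∎
    where open ≋-Reasoning

  combination₃ : ∀ x y z {a b c} → a ≋ 0ℤ → b ≋ 0ℤ → c ≋ 0ℤ → x * a + y * b + z * c ≋ 0ℤ
  combination₃ x y z {a} {b} {c} a≋0 b≋0 c≋0 =
    ≋-trans (≡⇒≋ (cong (_+ z * c) (sym (ℤP.*-identityˡ (x * a + y * b)))))
            (combination₂ 1ℤ z (combination₂ x y a≋0 b≋0) c≋0)

  MomentCongruence : (ℕ → ℤ) → ℕ → Set
  MomentCongruence T k = + suc k * T k + 1ℤ ≋ 0ℤ

  moment-at : ∀ {T} → (∀ m → m < 5 → MomentCongruence T m) →
              ∀ m → {True (m ℕP.<? 5)} → MomentCongruence T m
  moment-at d m {m<5} = d m (toWitness m<5)

  recurrence-constraint : ∀ {s r} {T : ℕ → ℤ} k → Recurrence s r T k →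
    MomentCongruence T k → MomentCongruence T (suc k) → MomentCongruence T (suc (suc k)) →
    + suc k * + (2 ℕ.+ k) - + suc k * + (3 ℕ.+ k) * s + + (2 ℕ.+ k) * + (3 ℕ.+ k) * r ≋ 0ℤ
  recurrence-constraint {s} {r} {T} k step d₀ d₁ d₂ = begin
    K₁ * K₂ - K₁ * K₃ * s + K₂ * K₃ * r
      ≡⟨ identity (+ k) s r (T k) (T (suc k)) ⟩
    K₁ * K₂ * (K₃ * (s * T (suc k) - r * T k) + 1ℤ)
      + - (K₁ * K₃ * s) * (K₂ * T (suc k) + 1ℤ) + K₂ * K₃ * r * (K₁ * T k + 1ℤ)
      ≡⟨ cong (λ t → K₁ * K₂ * (K₃ * t + 1ℤ) + - (K₁ * K₃ * s) * (K₂ * T (suc k) + 1ℤ)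
                     + K₂ * K₃ * r * (K₁ * T k + 1ℤ)) (sym step) ⟩
    K₁ * K₂ * (K₃ * T (suc (suc k)) + 1ℤ)
      + - (K₁ * K₃ * s) * (K₂ * T (suc k) + 1ℤ) + K₂ * K₃ * r * (K₁ * T k + 1ℤ)
      ≈⟨ combination₃ (K₁ * K₂) (- (K₁ * K₃ * s)) (K₂ * K₃ * r) d₂ d₁ d₀ ⟩
    0ℤ ∎
    where
    open ≋-Reasoning
    K₁ : ℤ
    K₁ = + suc k
    K₂ : ℤ
    K₂ = + (2 ℕ.+ k)
    K₃ : ℤ
    K₃ = + (3 ℕ.+ k)
    identity : ∀ K s r T₀ T₁ →
      (+ 1 + K) * (+ 2 + K) - (+ 1 + K) * (+ 3 + K) * s + (+ 2 + K) * (+ 3 + K) * r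
      ≡ (+ 1 + K) * (+ 2 + K) * ((+ 3 + K) * (s * T₁ - r * T₀) + 1ℤ)
        + - ((+ 1 + K) * (+ 3 + K) * s) * ((+ 2 + K) * T₁ + 1ℤ)
        + (+ 2 + K) * (+ 3 + K) * r * ((+ 1 + K) * T₀ + 1ℤ)
    identity = solve-∀

  order-two-obstruction : ∀ {T} → (∃₂ λ s r → ∀ k → Recurrence s r T k) →
                          (∀ m → m < 5 → MomentCongruence T m) → + 2 ≋ 0ℤ
  order-two-obstruction {T} (s , r , step) d = begin
    + 2                                   ≡⟨ combination s r ⟩
    + 10 * R₀ + - + 15 * R₁ + + 6 * R₂    ≈⟨ combination₃ (+ 10) (- + 15) (+ 6) R₀≋0 R₁≋0 R₂≋0 ⟩
    0ℤ ∎
    where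
    open ≋-Reasoning
    at : ∀ m → {True (m ℕP.<? 5)} → MomentCongruence T m
    at = moment-at {T} d
    R₀ : ℤ
    R₀ = + 1 * + 2 - + 1 * + 3 * s + + 2 * + 3 * r
    R₁ : ℤ
    R₁ = + 2 * + 3 - + 2 * + 4 * s + + 3 * + 4 * r
    R₂ : ℤ
    R₂ = + 3 * + 4 - + 3 * + 5 * s + + 4 * + 5 * r
    R₀≋0 : R₀ ≋ 0ℤ
    R₀≋0 = recurrence-constraint {s} {r} {T} 0 (step 0) (at 0) (at 1) (at 2)
    R₁≋0 : R₁ ≋ 0ℤ
    R₁≋0 = recurrence-constraint {s} {r} {T} 1 (step 1) (at 1) (at 2) (at 3)
    R₂≋0 : R₂ ≋ 0ℤ
    R₂≋0 = recurrence-constraint {s} {r} {T} 2 (step 2) (at 2) (at 3) (at 4)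
    combination : ∀ s r →
      + 2 ≡ + 10 * (+ 1 * + 2 - + 1 * + 3 * s + + 2 * + 3 * r)
            + - + 15 * (+ 2 * + 3 - + 2 * + 4 * s + + 3 * + 4 * r)
            + + 6 * (+ 3 * + 4 - + 3 * + 5 * s + + 4 * + 5 * r)
    combination = solve-∀

  root-one-obstruction : ∀ {T} → (∃ λ y → ∀ k → Recurrence (1ℤ + y) y T (suc k)) →
                         (∀ m → m < 5 → MomentCongruence T m) → + 2 ≋ 0ℤ
  root-one-obstruction {T} (y , step) d = begin
    + 2                    ≡⟨ combination y ⟩
    + 5 * R₁ + - + 4 * R₂  ≈⟨ combination₂ (+ 5) (- + 4) R₁≋0 R₂≋0 ⟩
    0ℤ ∎
    where
    open ≋-Reasoning
    at : ∀ m → {True (m ℕP.<? 5)} → MomentCongruence T m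
    at = moment-at {T} d
    R₁ : ℤ
    R₁ = + 2 * + 3 - + 2 * + 4 * (1ℤ + y) + + 3 * + 4 * y
    R₂ : ℤ
    R₂ = + 3 * + 4 - + 3 * + 5 * (1ℤ + y) + + 4 * + 5 * y
    R₁≋0 : R₁ ≋ 0ℤ
    R₁≋0 = recurrence-constraint {1ℤ + y} {y} {T} 1 (step 0) (at 1) (at 2) (at 3)
    R₂≋0 : R₂ ≋ 0ℤ
    R₂≋0 = recurrence-constraint {1ℤ + y} {y} {T} 2 (step 1) (at 2) (at 3) (at 4)
    combination : ∀ y →
      + 2 ≡ + 5 * (+ 2 * + 3 - + 2 * + 4 * (1ℤ + y) + + 3 * + 4 * y)
            + - + 4 * (+ 3 * + 4 - + 3 * + 5 * (1ℤ + y) + + 4 * + 5 * y)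
    combination = solve-∀

length-filter-complement : ∀ {A : Set} {P : Pred A 0ℓ} (P? : Decidable P) xs →
                           length (filter P? xs) ℕ.+ length (filter (∁? P?) xs) ≡ length xs
length-filter-complement P? [] = refl
length-filter-complement P? (x ∷ xs) with P? x
... | yes _ = cong suc (length-filter-complement P? xs)
... | no _ = trans (ℕP.+-suc _ _) (cong suc (length-filter-complement P? xs))

module Fibres (r : ℕ) (p-prime : Prime (7 ℕ.+ r)) (a : Fin (7 ℕ.+ r)) where

  open OddPrime (4 ℕ.+ r) p-prime
  open Obstruction p

  A : ℤ
  A = + toℕ a

  InFibre : Pred (Fin p) 0ℓ
  InFibre x = φ̄ p x ≡ toℕ a

  inFibre? : Decidable InFibre
  inFibre? x = φ̄ p x ℕ.≟ toℕ a

  complement : List (Fin p)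
  complement = filter (∁? inFibre?) (allFin p)

  weight point : Fin p → ℤ
  weight x = φ p (+ toℕ x) - A
  point x = + toℕ x

  T : ℕ → ℤ
  T = powerSum weight point complement

  -- Points of the fibre contribute nothing modulo p, so T satisfies the
  -- moment congruences of φ - A.
  complement-moments : ∀ m → m < 5 → MomentCongruence T m
  complement-moments m m<5 = begin
    + suc m * T m + 1ℤ
      ≈⟨ +-cong (*-cong (≋-refl {+ suc m}) (≋-sym fibre-drops)) (≋-refl {1ℤ}) ⟩
    + suc m * Σ p (λ x → (φ p (+ x) - A) * (+ x) ^ m) + 1ℤ
      ≈⟨ moment m (ℕP.<-≤-trans m<5 (ℕP.m≤m+n 5 (1 ℕ.+ r))) A ⟩
    0ℤ ∎
    where
    open ≋-Reasoning
    term : Fin p → ℤ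
    term x = weight x * point x ^ m
    in-fibre≋0 : ∀ x → InFibre x → term x ≋ 0ℤ
    in-fibre≋0 x x∈F = begin
      (φ p (+ toℕ x) - A) * point x ^ m ≈⟨ *-cong (+-cong (%ℕ-≋ (φ p (+ toℕ x)) x∈F) (≋-refl { - A}))
                                                 (≋-refl {point x ^ m}) ⟩
      (A - A) * point x ^ m             ≡⟨ cong (_* point x ^ m) (ℤP.+-inverseʳ A) ⟩
      0ℤ * point x ^ m                  ≡⟨ ℤP.*-zeroˡ (point x ^ m) ⟩
      0ℤ ∎
    fibre-drops : Σ p (λ x → (φ p (+ x) - A) * (+ x) ^ m) ≋ T m
    fibre-drops = ≋-trans (≡⇒≋ (sym (listSum-tabulate term (λ x → x))))
                          (listSum-filter inFibre? term in-fibre≋0 (allFin p))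

  fibre-bound : ∀ k → k ≤ length complement → fiberSize p a ≤ p ∸ k
  fibre-bound k k≤L = begin
    F                  ≡⟨ sym (ℕP.m+n∸n≡m F L) ⟩
    F ℕ.+ L ∸ L        ≡⟨ cong (_∸ L) (trans (length-filter-complement inFibre? (allFin p))
                                             (length-tabulate (λ x → x))) ⟩
    p ∸ L              ≤⟨ ℕP.∸-monoʳ-≤ p k≤L ⟩
    p ∸ k ∎
    where
    open ℕP.≤-Reasoning
    F : ℕ
    F = fiberSize p a
    L : ℕ
    L = length complement

  two≢0 : ¬ (+ 2 ≋ 0ℤ)
  two≢0 2≋0 = contradiction (below-p 2 (s≤s (s≤s (s≤s z≤n))) 2≋0) λ ()

  -- Every fibre misses at least three points: otherwise T would be a power
  -- sum over at most two points.
  fibre-bound-3 : fiberSize p a ≤ p ∸ 3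
  fibre-bound-3 = by-cases (3 ≤? length complement)
    where
    by-cases : Dec (3 ≤ length complement) → fiberSize p a ≤ p ∸ 3
    by-cases (yes 3≤L) = fibre-bound 3 3≤L
    by-cases (no 3≰L) = contradiction
      (order-two-obstruction {T} (at-most-two-points weight point complement (ℕP.≤-pred (ℕP.≰⇒> 3≰L)))
                             complement-moments)
      two≢0

  -- Over a ≠ 0 the complement contains 0 and 1, as φ(0) = φ(1) = 0.
  rest : List (Fin p)
  rest = filter (∁? inFibre?) (tabulate (Fin.suc ∘ Fin.suc))

  complement-splits : toℕ a ≢ 0 → complement ≡ Fin.zero ∷ Fin.suc Fin.zero ∷ rest
  complement-splits a≢0 = trans (filter-accept (∁? inFibre?) (misses 0ℤ φ-zero))
                                (cong (Fin.zero ∷_) (filter-accept (∁? inFibre?) (misses 1ℤ φ-one)))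
    where
    misses : ∀ z → φ p z ≡ 0ℤ → ¬ (φ p z %ℕ p ≡ toℕ a)
    misses z φz≡0 φz≡a = a≢0 (trans (sym φz≡a) (cong (_%ℕ p) φz≡0))

  -- Hence a fibre over a ≠ 0 misses at least two further points: otherwise T
  -- would be a power sum over 0, 1 and at most one more point.
  fibre-bound-4 : toℕ a ≢ 0 → fiberSize p a ≤ p ∸ 4
  fibre-bound-4 a≢0 = by-cases (2 ≤? length rest)
    where
    by-cases : Dec (2 ≤ length rest) → fiberSize p a ≤ p ∸ 4
    by-cases (yes 2≤rest) =
      fibre-bound 4 (subst (λ L → 4 ≤ length L) (sym (complement-splits a≢0)) (s≤s (s≤s 2≤rest)))
    by-cases (no 2≰rest) = contradiction
      (root-one-obstruction {T}
        (subst (λ L → ∃ λ y → ∀ k → Recurrence (1ℤ + y) y (powerSum weight point L) (suc k))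
               (sym (complement-splits a≢0))
               (zero-one-and-one-more weight point Fin.zero (Fin.suc Fin.zero) rest refl refl
                 (ℕP.≤-pred (ℕP.≰⇒> 2≰rest))))
        complement-moments)
      two≢0

lemma4p8 : (p : ℕ) .{{_ : NonZero p}} → Prime p → 7 ≤ p →
           ((a : Fin p) → toℕ a ≡ 0 → fiberSize p a ≤ p ∸ 3)
           × ((a : Fin p) → toℕ a ≢ 0 → fiberSize p a ≤ p ∸ 4)
lemma4p8 .(7 ℕ.+ r) p-prime (s≤s (s≤s (s≤s (s≤s (s≤s (s≤s (s≤s {n = r} z≤n))))))) =
  (λ a _ → Fibres.fibre-bound-3 r p-prime a) , (λ a → Fibres.fibre-bound-4 r p-prime a)
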